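{- Let $W_{\Delta,n}$ be a Knödel graph with $\Delta\ge3$ and $n\ge 4(\Delta-3)(2^{\Delta-1}-1)+4$, and let $s=2^{\Delta-1}-1$. If $(\Delta-3)s+1\le i\le j\le\lfloor n/4\rfloor$, then \[ d(u_0,u_i)\le d(u_0,u_j)\le d(u_0,u_{\lfloor n/4\rfloor})=2\left\lceil\frac{1}{s}\left\lfloor\frac n4\right\rfloor\right\rceil.\]
   Context: Knödel graph: for an even integer $n$ and an integer $\Delta$ with $1\le\Delta\le\lfloor\log_2 n\rfloor$, $W_{\Delta,n}$ is the simple bipartite graph with vertex set $U\cup V$, $U=\{u_0,\dots,u_{n/2-1}\}$, $V=\{v_0,\dots,v_{n/2-1}\}$; indices are read modulo $n/2$. The vertices $u_i$ and $v_j$ are adjacent iff $j-i\equiv 2^k-1\pmod{n/2}$ for some $k\in\{0,\dots,\Delta-1\}$; no other edges. $d(x,y)$ is the graph distance. -}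

module Defs where

open import Data.Nat using (ℕ; zero; suc; _+_; _*_; _∸_; _^_; _≤_; _<_)
open import Data.Nat.DivMod using (_/_)
open import Data.Fin using (Fin; toℕ)
open import Data.Product using (Σ; ∃; ∃₂; _×_; _,_)
open import Relation.Binary.PropositionalEquality using (_≡_)

ModEq : ℕ → ℕ → ℕ → Set
ModEq m x y = ∃₂ λ a b → x + a * m ≡ y + b * m

-- ceiling division (⌈ x / y ⌉ for y ≥ 1; arbitrary value 0 for y = 0)
ceilDiv : ℕ → ℕ → ℕ
ceilDiv x zero = 0
ceilDiv x (suc y) = (x + y) / suc y

-- vertices of W_{Δ,n}, where h = n/2: u_i = U i and v_j = V j
data Vtx (h : ℕ) : Set where
  U : Fin h → Vtx h
  V : Fin h → Vtx h

KEdge : (Δ h : ℕ) → Fin h → Fin h → Set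
KEdge Δ h i j = Σ ℕ λ k → k < Δ × ModEq h (toℕ j) (toℕ i + (2 ^ k ∸ 1))

data Adj (Δ h : ℕ) : Vtx h → Vtx h → Set where
  uv : ∀ {i j} → KEdge Δ h i j → Adj Δ h (U i) (V j)
  vu : ∀ {i j} → KEdge Δ h i j → Adj Δ h (V j) (U i)

data Walk (Δ h : ℕ) : Vtx h → Vtx h → ℕ → Set where
  here : ∀ {x} → Walk Δ h x x 0
  step : ∀ {x y z k} → Adj Δ h x y → Walk Δ h y z k → Walk Δ h x z (suc k)

Dist : (Δ n : ℕ) → Vtx (n / 2) → Vtx (n / 2) → ℕ → Set
Dist Δ n x y d = Walk Δ (n / 2) x y d × (∀ m → Walk Δ (n / 2) x y m → d ≤ m)

-- Write Δ = 3 + e, E = Δ - 1, T = 2^E, S = T - 1 and h = n/2.  A walk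
-- u_c → v → u → … alternates "up" edges, adding a jump 2^k - 1 ∈ [0,S] to the
-- index, and "down" edges, subtracting one.  For 2x ≤ h and x > eS we show
-- d(u₀,u_x) = 2⌈x/S⌉:
--   * lower bound: a walk u₀ → u_x of length 2m gives A ≡ x + B (mod h) with
--     A, B ≤ mS (total up and down jumps); since 2x ≤ h this forces x ≤ mS;
--   * upper bound: with M = ⌈x/S⌉ we find exponent lists as, bs of length M,
--     all exponents ≤ E, with Σ 2^a = x + Σ 2^b.  Usually as = (E,…,E) and bs
--     represents M·T - x as a sum of exactly M powers of two, obtained from a
--     short binary representation by repeatedly splitting 2^(k+1) = 2^k + 2^k;
--     one exceptional value of x needs a slightly different as.  Every pair
--     (a,b) is realised by two edges, so the walk has length 2M.
-- Monotonicity of ⌈·/S⌉ then gives the chain of inequalities of the theorem.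
module Submission where

open import Defs
open import Data.Nat using (ℕ; zero; suc; _+_; _*_; _∸_; _^_; _≤_; _<_; z≤n; s≤s; z<s; NonZero; _≤?_)
open import Data.Nat.Properties
open import Data.Nat.DivMod using (_/_; _%_; m≡m%n+[m/n]*n; m%n<n; [m+kn]%n≡m%n; m<n⇒m%n≡m; m/n*n≤m; /-mono-≤; m/n/o≡m/[n*o])
open import Data.Nat.Divisibility using (_∣_)
open import Data.Nat.Logarithm using (⌊log₂_⌋)
open import Data.Nat.Tactic.RingSolver using (solve-∀)
open import Data.Fin using (Fin; toℕ; fromℕ<)
open import Data.Fin.Properties using (toℕ-injective; toℕ<n; toℕ-fromℕ<)
open import Data.List using (List; []; _∷_; length; map; replicate; downFrom)
open import Data.Nat.ListAction using (sum)
open import Data.List.Relation.Unary.All as All using (All; []; _∷_)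
open import Data.List.Properties using (length-replicate; length-downFrom)
open import Data.List.Relation.Unary.All.Properties using (replicate⁺; applyDownFrom⁺₁)
open import Data.Product using (∃; ∃₂; _×_; _,_)
open import Data.Sum using (_⊎_; inj₁; inj₂)
open import Relation.Binary.Bundles using (Setoid)
import Relation.Binary.Reasoning.Setoid as SetoidReasoning
open import Relation.Binary.PropositionalEquality
open import Relation.Nullary using (yes; no)

module Congruence (h : ℕ) where

  infix 4 _≋_
  _≋_ : ℕ → ℕ → Set
  x ≋ y = ModEq h x y

  ≋-refl : ∀ {x} → x ≋ x
  ≋-refl = 0 , 0 , refl

  ≋-reflexive : ∀ {x y} → x ≡ y → x ≋ y
  ≋-reflexive refl = ≋-refl

  ≋-sym : ∀ {x y} → x ≋ y → y ≋ x
  ≋-sym (a , b , eq) = b , a , sym eq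

  ≋-trans : ∀ {x y z} → x ≋ y → y ≋ z → x ≋ z
  ≋-trans {x} {y} {z} (a , b , p) (c , d , q) = a + c , b + d , (begin
    x + (a + c) * h   ≡⟨ regroup x a c h ⟩
    x + a * h + c * h ≡⟨ cong (_+ c * h) p ⟩
    y + b * h + c * h ≡⟨ swap y b c h ⟩
    y + c * h + b * h ≡⟨ cong (_+ b * h) q ⟩
    z + d * h + b * h ≡⟨ sym (regroup z d b h) ⟩
    z + (d + b) * h   ≡⟨ cong (λ k → z + k * h) (+-comm d b) ⟩
    z + (b + d) * h   ∎)
    where
    open ≡-Reasoning
    regroup : ∀ w k l m → w + (k + l) * m ≡ w + k * m + l * m
    regroup = solve-∀
    swap : ∀ w k l m → w + k * m + l * m ≡ w + l * m + k * m
    swap = solve-∀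

  ≋-setoid : Setoid _ _
  ≋-setoid = record
    { Carrier = ℕ ; _≈_ = _≋_
    ; isEquivalence = record { refl = ≋-refl ; sym = ≋-sym ; trans = ≋-trans } }

  module ≋-Reasoning = SetoidReasoning ≋-setoid

  ≋-+ʳ : ∀ {x y} k → x ≋ y → x + k ≋ y + k
  ≋-+ʳ {x} {y} k (a , b , eq) = a , b , (begin
    x + k + a * h ≡⟨ swap x k a h ⟩
    x + a * h + k ≡⟨ cong (_+ k) eq ⟩
    y + b * h + k ≡⟨ sym (swap y k b h) ⟩
    y + k + b * h ∎)
    where
    open ≡-Reasoning
    swap : ∀ w k a m → w + k + a * m ≡ w + a * m + k
    swap = solve-∀

  ≋-cancelʳ : ∀ {x y} k → x + k ≋ y + k → x ≋ y
  ≋-cancelʳ {x} {y} k (a , b , eq) = a , b , +-cancelʳ-≡ k _ _ (begin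
    x + a * h + k ≡⟨ swap x a k h ⟩
    x + k + a * h ≡⟨ eq ⟩
    y + k + b * h ≡⟨ sym (swap y b k h) ⟩
    y + b * h + k ∎)
    where
    open ≡-Reasoning
    swap : ∀ w a k m → w + a * m + k ≡ w + k + a * m
    swap = solve-∀

  ≋-multiple : ∀ x k → x + k * h ≋ x
  ≋-multiple x k = 0 , k , +-identityʳ (x + k * h)

  -- If A ≡ x + B (mod h) with 2x ≤ h, then x is at most A or at most B:
  -- going around the cycle of length h "costs" at least h - x ≥ x.
  shift≤bound : ∀ {x A B K} → A ≋ x + B → A ≤ K → B ≤ K → x + x ≤ h → x ≤ K
  shift≤bound {x} {A} {B} {K} (X , Y , eq) A≤K B≤K 2x≤h with X ≤? Y
  ... | yes X≤Y = ≤-trans x≤A A≤K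
    where
    open ≤-Reasoning
    x≤A : x ≤ A
    x≤A = +-cancelʳ-≤ (X * h) x A (begin
      x + X * h     ≤⟨ +-monoʳ-≤ x (*-monoˡ-≤ h X≤Y) ⟩
      x + Y * h     ≤⟨ +-monoˡ-≤ (Y * h) (m≤m+n x B) ⟩
      x + B + Y * h ≡⟨ sym eq ⟩
      A + X * h     ∎)
  ... | no X≰Y = ≤-trans x≤B B≤K
    where
    open ≤-Reasoning
    h≤x+B : h ≤ x + B
    h≤x+B = +-cancelʳ-≤ (Y * h) h (x + B) (begin
      h + Y * h ≡⟨⟩
      suc Y * h ≤⟨ *-monoˡ-≤ h (≰⇒> X≰Y) ⟩
      X * h     ≤⟨ m≤n+m (X * h) A ⟩
      A + X * h ≡⟨ eq ⟩
      x + B + Y * h ∎)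
    x≤B : x ≤ B
    x≤B = +-cancelˡ-≤ x x B (≤-trans 2x≤h h≤x+B)

  module _ .{{_ : NonZero h}} where

    residue : ℕ → Fin h
    residue x = fromℕ< (m%n<n x h)

    residue-≋ : ∀ x → toℕ (residue x) ≋ x
    residue-≋ x = x / h , 0 , (begin
      toℕ (residue x) + x / h * h ≡⟨ cong (_+ x / h * h) (toℕ-fromℕ< (m%n<n x h)) ⟩
      x % h + x / h * h           ≡⟨ sym (m≡m%n+[m/n]*n x h) ⟩
      x                           ≡⟨ sym (+-identityʳ x) ⟩
      x + 0 * h                   ∎)
      where open ≡-Reasoning

    ≋⇒≡ : ∀ {c t : Fin h} → toℕ c ≋ toℕ t → c ≡ t
    ≋⇒≡ {c} {t} (a , b , eq) = toℕ-injective (begin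
      toℕ c                   ≡⟨ sym (m<n⇒m%n≡m (toℕ<n c)) ⟩
      toℕ c % h               ≡⟨ sym ([m+kn]%n≡m%n (toℕ c) a h) ⟩
      (toℕ c + a * h) % h     ≡⟨ cong (_% h) eq ⟩
      (toℕ t + b * h) % h     ≡⟨ [m+kn]%n≡m%n (toℕ t) b h ⟩
      toℕ t % h               ≡⟨ m<n⇒m%n≡m (toℕ<n t) ⟩
      toℕ t                   ∎)
      where open ≡-Reasoning

ceilDiv-cover : ∀ x {S} → 0 < S → x ≤ ceilDiv x S * S
ceilDiv-cover x {suc y} _ = +-cancelʳ-≤ y x _ (begin
  x + y                                     ≡⟨ m≡m%n+[m/n]*n (x + y) (suc y) ⟩
  (x + y) % suc y + (x + y) / suc y * suc y ≤⟨ +-monoˡ-≤ _ (≤-pred (m%n<n (x + y) (suc y))) ⟩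
  y + (x + y) / suc y * suc y               ≡⟨ +-comm y _ ⟩
  (x + y) / suc y * suc y + y               ∎)
  where open ≤-Reasoning

ceilDiv-tight : ∀ x {S} → 0 < S → ceilDiv x S * S < x + S
ceilDiv-tight x {suc y} _ = begin-strict
  (x + y) / suc y * suc y ≤⟨ m/n*n≤m (x + y) (suc y) ⟩
  x + y                   <⟨ +-monoʳ-< x (n<1+n y) ⟩
  x + suc y               ∎
  where open ≤-Reasoning

ceilDiv-least : ∀ x {S m} → 0 < S → x ≤ m * S → ceilDiv x S ≤ m
ceilDiv-least x {S} {m} 0<S x≤mS = ≤-pred (*-cancelʳ-< S _ (suc m) (begin-strict
  ceilDiv x S * S <⟨ ceilDiv-tight x 0<S ⟩
  x + S           ≤⟨ +-monoˡ-≤ S x≤mS ⟩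
  m * S + S       ≡⟨ +-comm (m * S) S ⟩
  suc m * S       ∎))
  where open ≤-Reasoning

ceilDiv-mono : ∀ S {x x′} → x ≤ x′ → ceilDiv x S ≤ ceilDiv x′ S
ceilDiv-mono zero    _    = z≤n
ceilDiv-mono (suc y) x≤x′ = /-mono-≤ (+-monoˡ-≤ y x≤x′) (≤-refl {suc y})

powerSum : List ℕ → ℕ
powerSum bs = sum (map (2 ^_) bs)

2^-double : ∀ k → 2 ^ suc k ≡ 2 ^ k + 2 ^ k
2^-double k = cong (2 ^ k +_) (+-identityʳ (2 ^ k))

2^-cancel-≤ : ∀ {m n} → 2 ^ m ≤ 2 ^ n → m ≤ n
2^-cancel-≤ 2^m≤2^n = ≮⇒≥ (λ n<m → <⇒≱ (^-monoʳ-< 2 (s≤s (s≤s z≤n)) n<m) 2^m≤2^n)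

powerSum-replicate : ∀ k b → powerSum (replicate k b) ≡ k * 2 ^ b
powerSum-replicate zero    b = refl
powerSum-replicate (suc k) b = cong (2 ^ b +_) (powerSum-replicate k b)

powerSum-downFrom : ∀ m → suc (powerSum (downFrom m)) ≡ 2 ^ m
powerSum-downFrom zero    = refl
powerSum-downFrom (suc m) = begin
  suc (2 ^ m + powerSum (downFrom m)) ≡⟨ sym (+-suc (2 ^ m) _) ⟩
  2 ^ m + suc (powerSum (downFrom m)) ≡⟨ cong (2 ^ m +_) (powerSum-downFrom m) ⟩
  2 ^ m + 2 ^ m                       ≡⟨ sym (2^-double m) ⟩
  2 ^ suc m                           ∎
  where open ≡-Reasoning

-- Binary representation of N with exponents below k; the number p of terms
-- satisfies 2^p ≤ N + 1 (the least number with p binary digits 1 is 2^p - 1).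
BinaryRep : ℕ → ℕ → Set
BinaryRep k N = ∃ λ bs → All (_< k) bs × powerSum bs ≡ N × 2 ^ length bs ≤ suc N

addTopTerm : ∀ k R → R < 2 ^ k → BinaryRep k R → BinaryRep (suc k) (2 ^ k + R)
addTopTerm k R R<2^k (bs , bs<k , sum≡R , size) =
  k ∷ bs , n<1+n k ∷ All.map m<n⇒m<1+n bs<k , cong (2 ^ k +_) sum≡R , size′
  where
  open ≤-Reasoning
  size′ : 2 ^ suc (length bs) ≤ suc (2 ^ k + R)
  size′ = begin
    2 ^ suc (length bs)           ≡⟨ 2^-double (length bs) ⟩
    2 ^ length bs + 2 ^ length bs ≤⟨ +-mono-≤ (≤-trans size R<2^k) size ⟩
    2 ^ k + suc R                 ≡⟨ +-suc (2 ^ k) R ⟩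
    suc (2 ^ k + R)               ∎

binary : ∀ k N → N < 2 ^ k → BinaryRep k N
binary zero    zero    _ = [] , [] , refl , ≤-refl
binary zero    (suc N) (s≤s ())
binary (suc k) N       N<2^[1+k] with N <? 2 ^ k
... | yes N<2^k with binary k N N<2^k
...   | bs , bs<k , sum≡N , size = bs , All.map m<n⇒m<1+n bs<k , sum≡N , size
binary (suc k) N       N<2^[1+k] | no N≮2^k with m≤n⇒∃[o]m+o≡n (≮⇒≥ N≮2^k)
... | R , refl = addTopTerm k R R<2^k (binary k R R<2^k)
  where
  R<2^k : R < 2 ^ k
  R<2^k = +-cancelˡ-< (2 ^ k) R (2 ^ k) (subst (2 ^ k + R <_) (2^-double k) N<2^[1+k])

-- Splitting one term 2^(b+1) = 2^b + 2^b adds a term without changing the sum;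
-- this is possible as long as some term exceeds 1, i.e. #terms < sum.
splitTerm : ∀ {D} bs → All (_< D) bs → length bs < powerSum bs →
  ∃ λ bs′ → All (_< D) bs′ × length bs′ ≡ suc (length bs) × powerSum bs′ ≡ powerSum bs
splitTerm (zero ∷ bs) (0<D ∷ bs<D) (s≤s len<sum) with splitTerm bs bs<D len<sum
... | bs′ , bs′<D , len , sum = zero ∷ bs′ , 0<D ∷ bs′<D , cong suc len , cong suc sum
splitTerm {D} (suc b ∷ bs) (b+1<D ∷ bs<D) _ =
  b ∷ b ∷ bs , b<D ∷ b<D ∷ bs<D , refl ,
  trans (sym (+-assoc (2 ^ b) (2 ^ b) _)) (cong (_+ powerSum bs) (sym (2^-double b)))
  where
  b<D : b < D
  b<D = <-trans (n<1+n b) b+1<D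

stretch : ∀ {D} d bs → All (_< D) bs → d + length bs ≤ powerSum bs →
  ∃ λ bs′ → All (_< D) bs′ × length bs′ ≡ d + length bs × powerSum bs′ ≡ powerSum bs
stretch zero    bs bs<D _ = bs , bs<D , refl , refl
stretch (suc d) bs bs<D size with splitTerm bs bs<D (≤-trans (s≤s (m≤n+m _ d)) size)
... | bs₁ , bs₁<D , len₁ , sum₁
  with stretch d bs₁ bs₁<D (subst₂ _≤_ (trans (sym (+-suc d _)) (cong (d +_) (sym len₁))) (sym sum₁) size)
...   | bs₂ , bs₂<D , len₂ , sum₂ =
  bs₂ , bs₂<D , trans len₂ (trans (cong (d +_) len₁) (+-suc d (length bs))) , trans sum₂ sum₁

stretchTo : ∀ {D} M bs → All (_< D) bs → length bs ≤ M → M ≤ powerSum bs →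
  ∃ λ bs′ → All (_< D) bs′ × length bs′ ≡ M × powerSum bs′ ≡ powerSum bs
stretchTo M bs bs<D len≤M M≤sum with stretch (M ∸ length bs) bs bs<D (subst (_≤ powerSum bs) (sym (m∸n+n≡m len≤M)) M≤sum)
... | bs′ , bs′<D , len , sum = bs′ , bs′<D , trans len (m∸n+n≡m len≤M) , sum

ShortRep : ℕ → ℕ → ℕ → Set
ShortRep E M N = ∃ λ bs → All (_< suc E) bs × length bs ≤ M × powerSum bs ≡ N

-- Large N use
-- one term 2^E plus ones; small N use their binary representation.
fewPowers : ∀ E M N → E ≤ suc M → suc N < M + 2 ^ E →
  ShortRep E M N ⊎ (suc M ≡ E × suc N ≡ 2 ^ E)
fewPowers E M N E≤1+M bound with N <? 2 ^ E
fewPowers E M N E≤1+M bound | no N≮2^E with m≤n⇒∃[o]m+o≡n (≮⇒≥ N≮2^E)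
... | k , refl =
  inj₁ (E ∷ replicate k 0 , n<1+n E ∷ replicate⁺ k z<s ,
        subst (_≤ M) (cong suc (sym (length-replicate k))) 1+k≤M ,
        cong (2 ^ E +_) (trans (powerSum-replicate k 0) (*-identityʳ k)))
  where
  open ≤-Reasoning
  1+k≤M : suc k ≤ M
  1+k≤M = +-cancelʳ-≤ (2 ^ E) (suc k) M (begin
    suc k + 2 ^ E       ≡⟨ cong suc (+-comm k (2 ^ E)) ⟩
    suc (2 ^ E + k)     ≤⟨ n≤1+n _ ⟩
    suc (suc (2 ^ E + k)) ≤⟨ bound ⟩
    M + 2 ^ E           ∎)
fewPowers E M N E≤1+M bound | yes N<2^E with binary E N N<2^E
... | bs , bs<E , sum≡N , size with length bs ≤? M
...   | yes len≤M = inj₁ (bs , All.map m<n⇒m<1+n bs<E , len≤M , sum≡N)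
...   | no len≰M = inj₂ (1+M≡E , 1+N≡2^E)
  where
  2^[1+M]≤1+N : 2 ^ suc M ≤ suc N
  2^[1+M]≤1+N = ≤-trans (^-monoʳ-≤ 2 (≰⇒> len≰M)) size
  1+M≡E : suc M ≡ E
  1+M≡E = ≤-antisym (2^-cancel-≤ (≤-trans 2^[1+M]≤1+N N<2^E)) E≤1+M
  1+N≡2^E : suc N ≡ 2 ^ E
  1+N≡2^E = ≤-antisym N<2^E (subst (λ m → 2 ^ m ≤ suc N) 1+M≡E 2^[1+M]≤1+N)

jump : ℕ → ℕ
jump k = 2 ^ k ∸ 1

jump+1 : ∀ k → jump k + 1 ≡ 2 ^ k
jump+1 k = m∸n+n≡m (m^n>0 2 k)

-- Hops Δ M x: exponent lists for M up-jumps and M down-jumps, all exponents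
-- below Δ, whose powers of two (equivalently, as the lengths agree, whose
-- jumps) differ by x.
Hops : ℕ → ℕ → ℕ → Set
Hops Δ M x = ∃₂ λ as bs → length as ≡ M × length bs ≡ M ×
  All (_< Δ) as × All (_< Δ) bs × powerSum as ≡ x + powerSum bs

-- The parameters of W_{Δ,n} for Δ = e + 3: exponents 0 … E with E = Δ - 1,
-- T = 2^E, and the largest jump S = T - 1.
module Jumps (e : ℕ) where

  E : ℕ
  E = suc (suc e)

  T : ℕ
  T = 2 ^ E

  S : ℕ
  S = T ∸ 1

  1+S≡T : suc S ≡ T
  1+S≡T = trans (+-comm 1 S) (jump+1 E)

  0<S : 0 < S
  0<S = m<n⇒0<n∸m (^-monoʳ-< 2 (s≤s (s≤s z≤n)) {0} {E} z<s)

  jump≤S : ∀ {k} → k < suc E → jump k ≤ S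
  jump≤S k<Δ = ∸-monoˡ-≤ 1 (^-monoʳ-≤ 2 (≤-pred k<Δ))

  -- the exceptional case of fewPowers, where M = e + 1 and x = e·T + 1:
  -- exponent lists (e+1, E, …, E) up and (e, …, 1, 0) down
  exceptionalHops : ∀ x N → suc e * T ≡ x + N → suc N ≡ T → Hops (suc E) (suc e) x
  exceptionalHops x N total 1+N≡T =
    suc e ∷ replicate e E , downFrom (suc e) ,
    cong suc (length-replicate e) , length-downFrom (suc e) ,
    m<n⇒m<1+n (n<1+n (suc e)) ∷ replicate⁺ e (n<1+n E) ,
    applyDownFrom⁺₁ (λ i → i) (suc e) (λ i<1+e → <-trans i<1+e (<-trans (n<1+n (suc e)) (n<1+n E))) ,
    balance
    where
    open ≡-Reasoning
    x≡1+eT : x ≡ suc (e * T)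
    x≡1+eT = +-cancelˡ-≡ T _ _ (begin
      T + x             ≡⟨ +-comm T x ⟩
      x + T             ≡⟨ cong (x +_) (sym 1+N≡T) ⟩
      x + suc N         ≡⟨ +-suc x N ⟩
      suc (x + N)       ≡⟨ cong suc (sym total) ⟩
      suc (T + e * T)   ≡⟨ sym (+-suc T (e * T)) ⟩
      T + suc (e * T)   ∎)
    balance : 2 ^ suc e + powerSum (replicate e E) ≡ x + powerSum (downFrom (suc e))
    balance = begin
      2 ^ suc e + powerSum (replicate e E)      ≡⟨ cong (2 ^ suc e +_) (powerSum-replicate e E) ⟩
      2 ^ suc e + e * T                         ≡⟨ +-comm (2 ^ suc e) (e * T) ⟩
      e * T + 2 ^ suc e                         ≡⟨ cong (e * T +_) (sym (powerSum-downFrom (suc e))) ⟩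
      e * T + suc (powerSum (downFrom (suc e))) ≡⟨ +-suc (e * T) _ ⟩
      suc (e * T) + powerSum (downFrom (suc e)) ≡⟨ cong (_+ powerSum (downFrom (suc e))) (sym x≡1+eT) ⟩
      x + powerSum (downFrom (suc e))           ∎

  -- For e < M = ⌈x/S⌉ there are M up- and M down-jumps with net displacement x.
  -- Generically all up-jumps are S and the down-jumps sum to M·S - x < S.
  hopLists : ∀ x → e < ceilDiv x S → Hops (suc E) (ceilDiv x S) x
  hopLists x e<M = fromSlack (m≤n⇒∃[o]m+o≡n (ceilDiv-cover x 0<S))
    where
    M : ℕ
    M = ceilDiv x S
    fromSlack : (∃ λ r → x + r ≡ M * S) → Hops (suc E) M x
    fromSlack (r , x+r≡MS) = fromPowers (fewPowers E M (M + r) (s≤s e<M) bound)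
      where
      N : ℕ
      N = M + r
      r<S : r < S
      r<S = +-cancelˡ-< x r S (subst (_< x + S) (sym x+r≡MS) (ceilDiv-tight x 0<S))
      bound : suc N < M + T
      bound = begin-strict
        suc (M + r)  ≡⟨ sym (+-suc M r) ⟩
        M + suc r    <⟨ +-monoʳ-< M (s≤s r<S) ⟩
        M + suc S    ≡⟨ cong (M +_) 1+S≡T ⟩
        M + T        ∎
        where open ≤-Reasoning
      total : M * T ≡ x + N
      total = begin
        M * T       ≡⟨ cong (M *_) (sym 1+S≡T) ⟩
        M * suc S   ≡⟨ *-suc M S ⟩
        M + M * S   ≡⟨ cong (M +_) (sym x+r≡MS) ⟩
        M + (x + r) ≡⟨ sym (+-assoc M x r) ⟩
        M + x + r   ≡⟨ cong (_+ r) (+-comm M x) ⟩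
        x + M + r   ≡⟨ +-assoc x M r ⟩
        x + N       ∎
        where open ≡-Reasoning
      fromPowers : ShortRep E M N ⊎ (suc M ≡ E × suc N ≡ T) → Hops (suc E) M x
      fromPowers (inj₁ (bs₀ , bs₀<Δ , len≤M , sum≡N))
        with stretchTo M bs₀ bs₀<Δ len≤M (subst (M ≤_) (sym sum≡N) (m≤m+n M r))
      ... | bs , bs<Δ , len , sum =
        replicate M E , bs , length-replicate M , len , replicate⁺ M (n<1+n E) , bs<Δ ,
        trans (powerSum-replicate M E) (trans total (cong (x +_) (sym (trans sum sum≡N))))
      fromPowers (inj₂ (1+M≡E , 1+N≡T)) =
        subst (λ m → Hops (suc E) m x) (sym M≡1+e)
          (exceptionalHops x N (subst (λ m → m * T ≡ x + N) M≡1+e total) 1+N≡T)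
        where
        M≡1+e : M ≡ suc e
        M≡1+e = suc-injective 1+M≡E

Distance : (Δ h : ℕ) → Vtx h → Vtx h → ℕ → Set
Distance Δ h x y d = Walk Δ h x y d × (∀ m → Walk Δ h x y m → d ≤ m)

_++ʷ_ : ∀ {Δ h x y z k l} → Walk Δ h x y k → Walk Δ h y z l → Walk Δ h x z (k + l)
here       ++ʷ w = w
step xy yz ++ʷ w = step xy (yz ++ʷ w)

module Walks (Δ h′ : ℕ) where

  h : ℕ
  h = suc h′

  open Congruence h

  Hop : Fin h → ℕ → ℕ → Set
  Hop c a b = ∃ λ u → Walk Δ h (U c) (U u) 2 × toℕ u + 2 ^ b ≋ toℕ c + 2 ^ a

  hop : ∀ (c : Fin h) {a b} → a < Δ → b < Δ → Hop c a b
  hop c {a} {b} a<Δ b<Δ =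
    u , step (uv (a , a<Δ , residue-≋ _)) (step (vu (b , b<Δ , ≋-sym u+jb≋v)) here) , landing
    where
    open ≋-Reasoning
    v : Fin h
    v = residue (toℕ c + jump a)
    u : Fin h
    u = residue (toℕ v + jump b * h′)
    u+jb≋v : toℕ u + jump b ≋ toℕ v
    u+jb≋v = begin
      toℕ u + jump b                ≈⟨ ≋-+ʳ (jump b) (residue-≋ _) ⟩
      toℕ v + jump b * h′ + jump b  ≡⟨ wrap (toℕ v) (jump b) h′ ⟩
      toℕ v + jump b * h            ≈⟨ ≋-multiple (toℕ v) (jump b) ⟩
      toℕ v                         ∎
      where
      wrap : ∀ w j k → w + j * k + j ≡ w + j * (1 + k)
      wrap = solve-∀
    landing : toℕ u + 2 ^ b ≋ toℕ c + 2 ^ a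
    landing = begin
      toℕ u + 2 ^ b        ≡⟨ cong (toℕ u +_) (sym (jump+1 b)) ⟩
      toℕ u + (jump b + 1) ≡⟨ sym (+-assoc (toℕ u) (jump b) 1) ⟩
      toℕ u + jump b + 1   ≈⟨ ≋-+ʳ 1 (≋-trans u+jb≋v (residue-≋ _)) ⟩
      toℕ c + jump a + 1   ≡⟨ +-assoc (toℕ c) (jump a) 1 ⟩
      toℕ c + (jump a + 1) ≡⟨ cong (toℕ c +_) (jump+1 a) ⟩
      toℕ c + 2 ^ a        ∎

  hopWalk : ∀ (c t : Fin h) as bs → length as ≡ length bs → All (_< Δ) as → All (_< Δ) bs →
    toℕ c + powerSum as ≋ toℕ t + powerSum bs → Walk Δ h (U c) (U t) (2 * length as)
  hopWalk c t [] [] _ _ _ c≋t = subst (λ w → Walk Δ h (U c) (U w) 0) (≋⇒≡ (≋-cancelʳ 0 c≋t)) here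
  hopWalk c t (a ∷ as) (b ∷ bs) len (a<Δ ∷ as<Δ) (b<Δ ∷ bs<Δ) balanced =
    continue (hop c a<Δ b<Δ)
    where
    open ≋-Reasoning
    continue : Hop c a b → Walk Δ h (U c) (U t) (2 * suc (length as))
    continue (u , firstHop , landing) =
      subst (Walk Δ h (U c) (U t)) (sym (*-suc 2 (length as)))
        (firstHop ++ʷ hopWalk u t as bs (suc-injective len) as<Δ bs<Δ rest)
      where
      rest : toℕ u + powerSum as ≋ toℕ t + powerSum bs
      rest = ≋-cancelʳ (2 ^ b) (begin
        toℕ u + powerSum as + 2 ^ b   ≡⟨ swap (toℕ u) (powerSum as) (2 ^ b) ⟩
        toℕ u + 2 ^ b + powerSum as   ≈⟨ ≋-+ʳ (powerSum as) landing ⟩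
        toℕ c + 2 ^ a + powerSum as   ≡⟨ +-assoc (toℕ c) (2 ^ a) (powerSum as) ⟩
        toℕ c + (2 ^ a + powerSum as) ≈⟨ balanced ⟩
        toℕ t + (2 ^ b + powerSum bs) ≡⟨ cong (toℕ t +_) (+-comm (2 ^ b) (powerSum bs)) ⟩
        toℕ t + (powerSum bs + 2 ^ b) ≡⟨ sym (+-assoc (toℕ t) (powerSum bs) (2 ^ b)) ⟩
        toℕ t + powerSum bs + 2 ^ b   ∎)
        where
        swap : ∀ w p q → w + p + q ≡ w + q + p
        swap = solve-∀

  module Displacement (S : ℕ) (jump≤S : ∀ {k} → k < Δ → jump k ≤ S) where

    fromU : ∀ {c t L} → Walk Δ h (U c) (U t) L →
      ∃ λ m → ∃₂ λ A B → L ≡ 2 * m × A ≤ m * S × B ≤ m * S × toℕ c + A ≋ toℕ t + B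
    fromV : ∀ {j t L} → Walk Δ h (V j) (U t) L →
      ∃ λ m → ∃₂ λ A B → L ≡ suc (2 * m) × A ≤ m * S × B ≤ suc m * S × toℕ j + A ≋ toℕ t + B

    fromU here = 0 , 0 , 0 , refl , z≤n , z≤n , ≋-refl
    fromU {c} {t} (step (uv {j = j} (k , k<Δ , j≋c+k)) w) with fromV w
    ... | m , A , B , L≡ , A≤ , B≤ , disp =
      suc m , jump k + A , B , trans (cong suc L≡) (sym (*-suc 2 m)) ,
      +-mono-≤ (jump≤S k<Δ) A≤ , B≤ , (begin
        toℕ c + (jump k + A) ≡⟨ sym (+-assoc (toℕ c) (jump k) A) ⟩
        toℕ c + jump k + A   ≈⟨ ≋-+ʳ A (≋-sym j≋c+k) ⟩
        toℕ j + A            ≈⟨ disp ⟩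
        toℕ t + B            ∎)
      where open ≋-Reasoning

    fromV {j} {t} (step (vu {i = i} (k , k<Δ , j≋i+k)) w) with fromU w
    ... | m , A , B , L≡ , A≤ , B≤ , disp =
      m , A , jump k + B , cong suc L≡ , A≤ , +-mono-≤ (jump≤S k<Δ) B≤ , (begin
        toℕ j + A            ≈⟨ ≋-+ʳ A j≋i+k ⟩
        toℕ i + jump k + A   ≡⟨ swap (toℕ i) (jump k) A ⟩
        toℕ i + A + jump k   ≈⟨ ≋-+ʳ (jump k) disp ⟩
        toℕ t + B + jump k   ≡⟨ shift (toℕ t) B (jump k) ⟩
        toℕ t + (jump k + B) ∎)
      where
      open ≋-Reasoning
      swap : ∀ w p q → w + p + q ≡ w + q + p
      swap = solve-∀
      shift : ∀ w p q → w + p + q ≡ w + (q + p)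
      shift = solve-∀

distanceFormula : ∀ e {h} (z x : Fin h) → toℕ z ≡ 0 →
  e * Jumps.S e + 1 ≤ toℕ x → toℕ x + toℕ x ≤ h →
  ∀ {d} → Distance (suc (suc (suc e))) h (U z) (U x) d → d ≡ 2 * ceilDiv (toℕ x) (Jumps.S e)
distanceFormula e {suc h′} z x z≡0 eS<x 2x≤h {d} (walk , shortest) = ≤-antisym upper lower
  where
  open Jumps e
  open Congruence (suc h′)
  open Walks (suc E) h′
  open Displacement S jump≤S

  M : ℕ
  M = ceilDiv (toℕ x) S

  e<M : e < M
  e<M = *-cancelʳ-< S e M (begin-strict
    e * S   <⟨ subst (_≤ toℕ x) (+-comm (e * S) 1) eS<x ⟩
    toℕ x   ≤⟨ ceilDiv-cover (toℕ x) 0<S ⟩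
    M * S   ∎)
    where open ≤-Reasoning

  upper : d ≤ 2 * M
  upper = viaHops (hopLists (toℕ x) e<M)
    where
    viaHops : Hops (suc E) M (toℕ x) → d ≤ 2 * M
    viaHops (as , bs , len-as , len-bs , as<Δ , bs<Δ , balance) =
      subst (d ≤_) (cong (2 *_) len-as)
        (shortest _ (hopWalk z x as bs (trans len-as (sym len-bs)) as<Δ bs<Δ
          (≋-reflexive (trans (cong (_+ powerSum as) z≡0) balance))))

  lower : 2 * M ≤ d
  lower with fromU walk
  ... | m , A , B , d≡2m , A≤mS , B≤mS , displacement =
    subst (2 * M ≤_) (sym d≡2m) (*-monoʳ-≤ 2 (ceilDiv-least (toℕ x) {S} {m} 0<S
      (shift≤bound (subst (λ c → c + A ≋ toℕ x + B) z≡0 displacement) A≤mS B≤mS 2x≤h)))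

-- n/4 + n/4 ≤ n/2, so the index n/4 lies in the range of distanceFormula
quarter+quarter≤half : ∀ n → n / 4 + n / 4 ≤ n / 2
quarter+quarter≤half n = begin
  n / 4 + n / 4         ≡⟨ cong (λ q → q + q) (sym (m/n/o≡m/[n*o] n 2 2)) ⟩
  n / 2 / 2 + n / 2 / 2 ≡⟨ cong (n / 2 / 2 +_) (sym (+-identityʳ (n / 2 / 2))) ⟩
  2 * (n / 2 / 2)       ≡⟨ *-comm 2 (n / 2 / 2) ⟩
  n / 2 / 2 * 2         ≤⟨ m/n*n≤m (n / 2) 2 ⟩
  n / 2                 ∎
  where open ≤-Reasoning

mainTheorem10 : (Δ n : ℕ) → 2 ∣ n → 1 ≤ Δ → Δ ≤ ⌊log₂ n ⌋ →
    3 ≤ Δ → 4 * (Δ ∸ 3) * (2 ^ (Δ ∸ 1) ∸ 1) + 4 ≤ n →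
    (z i j q : Fin (n / 2)) → toℕ z ≡ 0 → toℕ q ≡ n / 4 →
    (Δ ∸ 3) * (2 ^ (Δ ∸ 1) ∸ 1) + 1 ≤ toℕ i → toℕ i ≤ toℕ j → toℕ j ≤ n / 4 →
    (di dj dq : ℕ) →
    Dist Δ n (U z) (U i) di → Dist Δ n (U z) (U j) dj → Dist Δ n (U z) (U q) dq →
    di ≤ dj × dj ≤ dq × dq ≡ 2 * ceilDiv (n / 4) (2 ^ (Δ ∸ 1) ∸ 1)
mainTheorem10 .(suc (suc (suc e))) n _ _ _ (s≤s (s≤s (s≤s {n = e} _))) _
              z i j q z≡0 q≡n/4 eS<i i≤j j≤n/4 di dj dq Di Dj Dq =
  subst₂ _≤_ (sym di≡) (sym dj≡) (twiceCeil-mono i≤j) ,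
  subst₂ _≤_ (sym dj≡) (sym dq≡) (twiceCeil-mono j≤q) ,
  trans dq≡ (cong (λ k → 2 * ceilDiv k S) q≡n/4)
  where
  open Jumps e using (S)

  twiceCeil-mono : ∀ {x y} → x ≤ y → 2 * ceilDiv x S ≤ 2 * ceilDiv y S
  twiceCeil-mono x≤y = *-monoʳ-≤ 2 (ceilDiv-mono S x≤y)

  j≤q : toℕ j ≤ toℕ q
  j≤q = subst (toℕ j ≤_) (sym q≡n/4) j≤n/4

  q-half : toℕ q + toℕ q ≤ n / 2
  q-half = subst (λ k → k + k ≤ n / 2) (sym q≡n/4) (quarter+quarter≤half n)

  j-half : toℕ j + toℕ j ≤ n / 2
  j-half = ≤-trans (+-mono-≤ j≤q j≤q) q-half

  i-half : toℕ i + toℕ i ≤ n / 2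
  i-half = ≤-trans (+-mono-≤ i≤j i≤j) j-half

  di≡ : di ≡ 2 * ceilDiv (toℕ i) S
  di≡ = distanceFormula e z i z≡0 eS<i i-half Di

  dj≡ : dj ≡ 2 * ceilDiv (toℕ j) S
  dj≡ = distanceFormula e z j z≡0 (≤-trans eS<i i≤j) j-half Dj

  dq≡ : dq ≡ 2 * ceilDiv (toℕ q) S
  dq≡ = distanceFormula e z q z≡0 (≤-trans eS<i (≤-trans i≤j j≤q)) q-half Dq
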